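{- Let $n\ge 2$ and $1\le i\le n-1$ be integers, and let $r_n(i)$ denote the total number of runs of ones of length exactly $i$, counted over all $2^n$ binary strings of length $n$. Then $$r_n(i)=\sum_{p=1}^{n-i}(p+1)\binom{n-i-1}{p-1}.$$
   Context: A run of ones in a binary string is a maximal block of consecutive ones, i.e. an uninterrupted sequence of ones flanked on each side either by a zero or by the start/end of the string; its length is the number of ones in it. The quantity $r_n(i)$ is obtained by summing, over all binary strings of length $n$, the number of runs of ones of length $i$ occurring in each string. -}

module Defs where

open import Data.Bool using (Bool; true; false)
open import Data.Nat using (ℕ; zero; suc; _+_; _≟_)
open import Data.List using (List; []; _∷_; map; length; filter; concatMap)
open import Data.Nat.ListAction using (sum)
open import Data.Vec using (Vec; []; _∷_; toList)

allStrings : (n : ℕ) → List (Vec Bool n)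
allStrings zero = [] ∷ []
allStrings (suc n) = concatMap (λ s → (false ∷ s) ∷ (true ∷ s) ∷ []) (allStrings n)

-- Lengths of the maximal runs of ones, scanning left to right with an
-- accumulator k = length of the run of ones currently being read.
runsAux : ℕ → List Bool → List ℕ
runsAux zero [] = []
runsAux (suc k) [] = suc k ∷ []
runsAux k (true ∷ bs) = runsAux (suc k) bs
runsAux zero (false ∷ bs) = runsAux zero bs
runsAux (suc k) (false ∷ bs) = suc k ∷ runsAux zero bs

runLengths : List Bool → List ℕ
runLengths = runsAux zero

runsOfLength : ℕ → List Bool → ℕ
runsOfLength i bs = length (filter (λ m → m ≟ i) (runLengths bs))

r : (n i : ℕ) → ℕ
r n i = sum (map (λ s → runsOfLength i (toList s)) (allStrings n))

sumFrom1 : ℕ → (ℕ → ℕ) → ℕ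
sumFrom1 zero f = 0
sumFrom1 (suc m) f = sumFrom1 m f + f (suc m)

-- With j = n − i − 1 both sides equal (j + 4)·2^(j−1).  Prepending a bit to every
-- string of length n doubles the number of runs of length i, except that prepending a
-- one to a string that starts with exactly i − 1 (resp. i) ones creates (resp. destroys)
-- such a run; for n > i there are 2^(n−i) resp. 2^(n−i−1) of those strings, so
-- r (n+1) i = 2 r n i + 2^(n−i−1), starting from r i i = 1 and r (i+1) i = 2.
-- On the other side, Pascal's rule gives Σ_q C(j,q) = 2^j and Σ_q q C(j,q) = j 2^(j−1).
module Submission where

open import Defs
open import Data.Nat using (ℕ; _+_; _*_; _∸_; _≤_)
open import Data.Nat.Combinatorics using (_C_)
open import Relation.Binary.PropositionalEquality using (_≡_)

open import Data.Bool using (Bool; true; false; if_then_else_)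
open import Data.List using (List; []; _∷_; map; length; filter; concatMap)
open import Data.List.Properties using (map-cong)
open import Data.Nat using (zero; suc; _^_; _<_; _≡ᵇ_; _≟_; s≤s)
open import Data.Nat.Combinatorics using (nCk+nC[k+1]≡[n+1]C[k+1]; k>n⇒nCk≡0)
open import Data.Nat.ListAction using (sum)
open import Data.Nat.Properties
open import Data.Nat.Tactic.RingSolver using (solve-∀)
open import Data.Product using (_,_)
open import Algebra.Properties.CommutativeSemigroup +-commutativeSemigroup
  using (interchange; xy∙z≈xz∙y; x∙yz≈xz∙y)
open import Data.Vec using (Vec; []; _∷_; toList)
open import Function using (_∘_)
open import Relation.Binary.PropositionalEquality using (refl; sym; trans; cong; cong₂; module ≡-Reasoning)

open ≡-Reasoning

sum-map-+ : ∀ {A : Set} (f g : A → ℕ) (xs : List A) →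
  sum (map (λ x → f x + g x) xs) ≡ sum (map f xs) + sum (map g xs)
sum-map-+ f g [] = refl
sum-map-+ f g (x ∷ xs) = begin
  f x + g x + sum (map (λ x → f x + g x) xs)  ≡⟨ cong (f x + g x +_) (sum-map-+ f g xs) ⟩
  f x + g x + (sum (map f xs) + sum (map g xs)) ≡⟨ interchange (f x) (g x) _ _ ⟩
  f x + sum (map f xs) + (g x + sum (map g xs)) ∎

sumStrings : (n : ℕ) → (Vec Bool n → ℕ) → ℕ
sumStrings n f = sum (map f (allStrings n))

sumStrings-+ : ∀ n (f g : Vec Bool n → ℕ) →
  sumStrings n (λ s → f s + g s) ≡ sumStrings n f + sumStrings n g
sumStrings-+ n f g = sum-map-+ f g (allStrings n)

sumStrings-cong : ∀ n {f g : Vec Bool n → ℕ} → (∀ s → f s ≡ g s) →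
  sumStrings n f ≡ sumStrings n g
sumStrings-cong n f≗g = cong sum (map-cong f≗g (allStrings n))

sumStrings-suc : ∀ n (f : Vec Bool (suc n) → ℕ) →
  sumStrings (suc n) f ≡ sumStrings n (f ∘ (false ∷_)) + sumStrings n (f ∘ (true ∷_))
sumStrings-suc n f = trans (sum-concatMap (allStrings n)) (sum-map-+ _ _ (allStrings n))
  where
  sum-concatMap : ∀ ss → sum (map f (concatMap (λ s → (false ∷ s) ∷ (true ∷ s) ∷ []) ss))
                         ≡ sum (map (λ s → f (false ∷ s) + f (true ∷ s)) ss)
  sum-concatMap [] = refl
  sum-concatMap (s ∷ ss) =
    trans (sym (+-assoc (f (false ∷ s)) _ _)) (cong (f (false ∷ s) + f (true ∷ s) +_) (sum-concatMap ss))

sumStrings-const : ∀ n c → sumStrings n (λ _ → c) ≡ c * 2 ^ n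
sumStrings-const zero c = trans (+-identityʳ c) (sym (*-identityʳ c))
sumStrings-const (suc n) c = begin
  sumStrings (suc n) (λ _ → c)        ≡⟨ sumStrings-suc n (λ _ → c) ⟩
  sumStrings n (λ _ → c) + sumStrings n (λ _ → c)
    ≡⟨ cong₂ _+_ (sumStrings-const n c) (sumStrings-const n c) ⟩
  c * 2 ^ n + c * 2 ^ n               ≡⟨ doubling c (2 ^ n) ⟩
  c * 2 ^ suc n                       ∎
  where
  doubling : ∀ a b → a * b + a * b ≡ a * (2 * b)
  doubling = solve-∀

δ : ℕ → ℕ → ℕ
δ i m = if m ≡ᵇ i then 1 else 0

occurrences : ℕ → List ℕ → ℕ
occurrences i ms = length (filter (_≟ i) ms)

occurrences-∷ : ∀ i m ms → occurrences i (m ∷ ms) ≡ δ i m + occurrences i ms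
occurrences-∷ i m ms with m ≡ᵇ i
... | true  = refl
... | false = refl

leadingOnes : List Bool → ℕ
leadingOnes []          = 0
leadingOnes (false ∷ _) = 0
leadingOnes (true ∷ bs) = suc (leadingOnes bs)

-- A pending run of k+1 ones absorbs the leading ones of bs: compared with reading bs
-- from scratch, the leading run is lengthened by k+1.
occurrences-runsAux-suc : ∀ i k bs →
  occurrences (suc i) (runsAux (suc k) bs) + δ (suc i) (leadingOnes bs)
    ≡ occurrences (suc i) (runLengths bs) + δ (suc i) (suc k + leadingOnes bs)
occurrences-runsAux-suc i k [] rewrite +-identityʳ k with k ≡ᵇ i
... | true  = refl
... | false = refl
occurrences-runsAux-suc i k (false ∷ bs) = begin
  occurrences (suc i) (suc k ∷ runLengths bs) + 0
    ≡⟨ trans (+-identityʳ _) (occurrences-∷ (suc i) (suc k) (runLengths bs)) ⟩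
  δ (suc i) (suc k) + occurrences (suc i) (runLengths bs)
    ≡⟨ +-comm (δ (suc i) (suc k)) _ ⟩
  occurrences (suc i) (runLengths bs) + δ (suc i) (suc k)
    ≡⟨ cong (λ m → occurrences (suc i) (runLengths bs) + δ (suc i) (suc m)) (sym (+-identityʳ k)) ⟩
  occurrences (suc i) (runLengths bs) + δ (suc i) (suc k + 0) ∎
occurrences-runsAux-suc i k (true ∷ bs) = +-cancelʳ-≡ x _ _ (begin
  a + y + x ≡⟨ xy∙z≈xz∙y a y x ⟩
  a + x + y ≡⟨ cong (_+ y) (occurrences-runsAux-suc i (suc k) bs) ⟩
  o + z + y ≡⟨ xy∙z≈xz∙y o z y ⟩
  o + y + z ≡⟨ cong (_+ z) (sym (occurrences-runsAux-suc i 0 bs)) ⟩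
  b + x + z ≡⟨ xy∙z≈xz∙y b x z ⟩
  b + z + x ≡⟨ cong (λ m → b + δ (suc i) (suc m) + x) (sym (+-suc k L)) ⟩
  b + δ (suc i) (suc k + suc L) + x ∎)
  where
  L = leadingOnes bs
  o = occurrences (suc i) (runLengths bs)
  a = occurrences (suc i) (runsAux (suc (suc k)) bs)
  b = occurrences (suc i) (runsAux 1 bs)
  x = δ (suc i) L
  y = δ (suc i) (suc L)
  z = δ (suc i) (suc (suc k + L))

leadingRuns : ℕ → ℕ → ℕ
leadingRuns n c = sumStrings n (λ s → δ c (leadingOnes (toList s)))

leadingRuns-suc-zero : ∀ n → leadingRuns (suc n) 0 ≡ 2 ^ n
leadingRuns-suc-zero n = begin
  leadingRuns (suc n) 0                           ≡⟨ sumStrings-suc n _ ⟩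
  sumStrings n (λ _ → 1) + sumStrings n (λ _ → 0) ≡⟨ cong₂ _+_ (sumStrings-const n 1) (sumStrings-const n 0) ⟩
  1 * 2 ^ n + 0                                   ≡⟨ trans (+-identityʳ _) (*-identityˡ _) ⟩
  2 ^ n                                           ∎

leadingRuns-suc-suc : ∀ n c → leadingRuns (suc n) (suc c) ≡ leadingRuns n c
leadingRuns-suc-suc n c = trans (sumStrings-suc n _) (cong (_+ leadingRuns n c) (sumStrings-const n 0))

leadingRuns-< : ∀ {n c} → n < c → leadingRuns n c ≡ 0
leadingRuns-< {zero}  {suc c} _         = refl
leadingRuns-< {suc n} {suc c} (s≤s n<c) = trans (leadingRuns-suc-suc n c) (leadingRuns-< n<c)

leadingRuns-diag : ∀ n → leadingRuns n n ≡ 1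
leadingRuns-diag zero    = refl
leadingRuns-diag (suc n) = trans (leadingRuns-suc-suc n n) (leadingRuns-diag n)

leadingRuns-+ : ∀ c m → leadingRuns (suc c + m) c ≡ 2 ^ m
leadingRuns-+ zero    m = leadingRuns-suc-zero m
leadingRuns-+ (suc c) m = trans (leadingRuns-suc-suc (suc c + m) c) (leadingRuns-+ c m)

-- Prepending a bit to every string doubles r, except that a prepended one turns a
-- leading run of length i into one of length i+1 and one of length i-1 into one of length i.
r-suc : ∀ n i → r (suc n) (suc i) + leadingRuns n (suc i) ≡ 2 * r n (suc i) + leadingRuns n i
r-suc n i = begin
  r (suc n) (suc i) + leadingRuns n (suc i)
    ≡⟨ cong (_+ leadingRuns n (suc i)) (sumStrings-suc n _) ⟩
  r n (suc i) + sumStrings n (occurrences (suc i) ∘ runsAux 1 ∘ toList) + leadingRuns n (suc i)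
    ≡⟨ +-assoc (r n (suc i)) _ _ ⟩
  r n (suc i) + (sumStrings n (occurrences (suc i) ∘ runsAux 1 ∘ toList) + leadingRuns n (suc i))
    ≡⟨ cong (r n (suc i) +_) (sym (sumStrings-+ n _ _)) ⟩
  r n (suc i) + sumStrings n (λ s → occurrences (suc i) (runsAux 1 (toList s)) + δ (suc i) (leadingOnes (toList s)))
    ≡⟨ cong (r n (suc i) +_) (sumStrings-cong n (occurrences-runsAux-suc i 0 ∘ toList)) ⟩
  r n (suc i) + sumStrings n (λ s → runsOfLength (suc i) (toList s) + δ i (leadingOnes (toList s)))
    ≡⟨ cong (r n (suc i) +_) (sumStrings-+ n _ _) ⟩
  r n (suc i) + (r n (suc i) + leadingRuns n i)
    ≡⟨ sym (+-assoc (r n (suc i)) _ _) ⟩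
  r n (suc i) + r n (suc i) + leadingRuns n i
    ≡⟨ cong (λ m → r n (suc i) + m + leadingRuns n i) (sym (+-identityʳ _)) ⟩
  2 * r n (suc i) + leadingRuns n i ∎

r-below : ∀ {n i} → n ≤ i → r n (suc i) ≡ 0
r-below {zero}      _   = refl
r-below {suc n} {i} n<i = begin
  r (suc n) (suc i)                         ≡⟨ sym (+-identityʳ _) ⟩
  r (suc n) (suc i) + 0                     ≡⟨ cong (r (suc n) (suc i) +_) (sym (leadingRuns-< (m<n⇒m<1+n n<i))) ⟩
  r (suc n) (suc i) + leadingRuns n (suc i) ≡⟨ r-suc n i ⟩
  2 * r n (suc i) + leadingRuns n i         ≡⟨ cong₂ (λ a b → 2 * a + b) (r-below (<⇒≤ n<i)) (leadingRuns-< n<i) ⟩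
  0                                         ∎

r-diag : ∀ i → r (suc i) (suc i) ≡ 1
r-diag i = begin
  r (suc i) (suc i)                         ≡⟨ sym (+-identityʳ _) ⟩
  r (suc i) (suc i) + 0                     ≡⟨ cong (r (suc i) (suc i) +_) (sym (leadingRuns-< (n<1+n i))) ⟩
  r (suc i) (suc i) + leadingRuns i (suc i) ≡⟨ r-suc i i ⟩
  2 * r i (suc i) + leadingRuns i i         ≡⟨ cong₂ (λ a b → 2 * a + b) (r-below (≤-refl {i})) (leadingRuns-diag i) ⟩
  1                                         ∎

r-suc-diag : ∀ i → r (suc (suc i)) (suc i) ≡ 2
r-suc-diag i = +-cancelʳ-≡ 1 _ _ (begin
  r (suc (suc i)) (suc i) + 1                           ≡⟨ cong (r (suc (suc i)) (suc i) +_) (sym (leadingRuns-diag (suc i))) ⟩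
  r (suc (suc i)) (suc i) + leadingRuns (suc i) (suc i) ≡⟨ r-suc (suc i) i ⟩
  2 * r (suc i) (suc i) + leadingRuns (suc i) i         ≡⟨ cong₂ (λ a b → 2 * a + b) (r-diag i) leadingRuns-suc ⟩
  2 + 1                                                 ∎)
  where
  leadingRuns-suc : leadingRuns (suc i) i ≡ 1
  leadingRuns-suc = trans (cong (λ n → leadingRuns n i) (sym (+-identityʳ (suc i)))) (leadingRuns-+ i 0)

r-suc-long : ∀ i j →
  r (suc (suc (suc i + j))) (suc i) + 2 ^ j ≡ 2 * r (suc (suc i + j)) (suc i) + 2 ^ suc j
r-suc-long i j = begin
  r (suc n) (suc i) + 2 ^ j                 ≡⟨ cong (r (suc n) (suc i) +_) (sym (leadingRuns-+ (suc i) j)) ⟩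
  r (suc n) (suc i) + leadingRuns n (suc i) ≡⟨ r-suc n i ⟩
  2 * r n (suc i) + leadingRuns n i         ≡⟨ cong (2 * r n (suc i) +_) leadingRuns-n ⟩
  2 * r n (suc i) + 2 ^ suc j               ∎
  where
  n = suc (suc i + j)
  leadingRuns-n : leadingRuns n i ≡ 2 ^ suc j
  leadingRuns-n = trans (cong (λ m → leadingRuns (suc m) i) (sym (+-suc i j))) (leadingRuns-+ i (suc j))

r-closed : ∀ i j → 2 * r (suc (suc i + j)) (suc i) ≡ (j + 4) * 2 ^ j
r-closed i zero = begin
  2 * r (suc (suc i + 0)) (suc i) ≡⟨ cong (λ n → 2 * r (suc n) (suc i)) (+-identityʳ (suc i)) ⟩
  2 * r (suc (suc i)) (suc i)     ≡⟨ cong (2 *_) (r-suc-diag i) ⟩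
  4                               ∎
r-closed i (suc j) = +-cancelʳ-≡ (2 * 2 ^ j) _ _ (begin
  2 * r (suc (suc i + suc j)) (suc i) + 2 * 2 ^ j
    ≡⟨ cong (λ m → 2 * r (suc m) (suc i) + 2 * 2 ^ j) (+-suc (suc i) j) ⟩
  2 * r (suc (suc (suc i + j))) (suc i) + 2 * 2 ^ j
    ≡⟨ sym (*-distribˡ-+ 2 (r (suc (suc (suc i + j))) (suc i)) (2 ^ j)) ⟩
  2 * (r (suc (suc (suc i + j))) (suc i) + 2 ^ j)
    ≡⟨ cong (2 *_) (r-suc-long i j) ⟩
  2 * (2 * r (suc (suc i + j)) (suc i) + 2 ^ suc j)
    ≡⟨ cong (λ x → 2 * (x + 2 ^ suc j)) (r-closed i j) ⟩
  2 * ((j + 4) * 2 ^ j + 2 * 2 ^ j)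
    ≡⟨ rearrange j (2 ^ j) ⟩
  (suc j + 4) * 2 ^ suc j + 2 * 2 ^ j ∎)
  where
  rearrange : ∀ j y → 2 * ((j + 4) * y + 2 * y) ≡ (suc j + 4) * (2 * y) + 2 * y
  rearrange = solve-∀

sum≤ : ℕ → (ℕ → ℕ) → ℕ
sum≤ zero    g = g 0
sum≤ (suc k) g = g 0 + sum≤ k (g ∘ suc)

sum≤-snoc : ∀ k g → sum≤ (suc k) g ≡ sum≤ k g + g (suc k)
sum≤-snoc zero    g = refl
sum≤-snoc (suc k) g = trans (cong (g 0 +_) (sum≤-snoc k (g ∘ suc))) (sym (+-assoc (g 0) _ _))

sum≤-cong : ∀ k {g h} → (∀ q → g q ≡ h q) → sum≤ k g ≡ sum≤ k h
sum≤-cong zero    g≗h = g≗h 0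
sum≤-cong (suc k) g≗h = cong₂ _+_ (g≗h 0) (sum≤-cong k (g≗h ∘ suc))

sum≤-+ : ∀ k g h → sum≤ k (λ q → g q + h q) ≡ sum≤ k g + sum≤ k h
sum≤-+ zero    g h = refl
sum≤-+ (suc k) g h = trans (cong (g 0 + h 0 +_) (sum≤-+ k (g ∘ suc) (h ∘ suc))) (interchange (g 0) (h 0) _ _)

sumFrom1-suc : ∀ k f → sumFrom1 (suc k) f ≡ sum≤ k (f ∘ suc)
sumFrom1-suc zero    f = refl
sumFrom1-suc (suc k) f = trans (cong (_+ f (suc (suc k))) (sumFrom1-suc k f)) (sym (sum≤-snoc k (f ∘ suc)))

binomialSum : ℕ → (ℕ → ℕ) → ℕ
binomialSum k g = sum≤ k (λ q → g q * (k C q))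

binomialSum-suc : ∀ k g → binomialSum (suc k) g ≡ binomialSum k g + binomialSum k (g ∘ suc)
binomialSum-suc k g = begin
  g 0 * 1 + sum≤ k (λ q → g (suc q) * (suc k C suc q))
    ≡⟨ cong (g 0 * 1 +_) (sum≤-cong k pascal) ⟩
  g 0 * 1 + sum≤ k (λ q → g (suc q) * (k C q) + g (suc q) * (k C suc q))
    ≡⟨ cong (g 0 * 1 +_) (sum≤-+ k _ _) ⟩
  g 0 * 1 + (binomialSum k (g ∘ suc) + sum≤ k (λ q → g (suc q) * (k C suc q)))
    ≡⟨ x∙yz≈xz∙y (g 0 * 1) _ _ ⟩
  sum≤ (suc k) (λ q → g q * (k C q)) + binomialSum k (g ∘ suc)
    ≡⟨ cong (_+ binomialSum k (g ∘ suc)) (sum≤-snoc k (λ q → g q * (k C q))) ⟩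
  binomialSum k g + g (suc k) * (k C suc k) + binomialSum k (g ∘ suc)
    ≡⟨ cong (λ c → binomialSum k g + g (suc k) * c + binomialSum k (g ∘ suc)) (k>n⇒nCk≡0 (n<1+n k)) ⟩
  binomialSum k g + g (suc k) * 0 + binomialSum k (g ∘ suc)
    ≡⟨ cong (λ x → binomialSum k g + x + binomialSum k (g ∘ suc)) (*-zeroʳ (g (suc k))) ⟩
  binomialSum k g + 0 + binomialSum k (g ∘ suc)
    ≡⟨ cong (_+ binomialSum k (g ∘ suc)) (+-identityʳ _) ⟩
  binomialSum k g + binomialSum k (g ∘ suc) ∎
  where
  pascal : ∀ q → g (suc q) * (suc k C suc q) ≡ g (suc q) * (k C q) + g (suc q) * (k C suc q)
  pascal q = trans (cong (g (suc q) *_) (sym (nCk+nC[k+1]≡[n+1]C[k+1] k q))) (*-distribˡ-+ (g (suc q)) _ _)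

binomialSum-1 : ∀ k → binomialSum k (λ _ → 1) ≡ 2 ^ k
binomialSum-1 zero    = refl
binomialSum-1 (suc k) = begin
  binomialSum (suc k) (λ _ → 1)                           ≡⟨ binomialSum-suc k (λ _ → 1) ⟩
  binomialSum k (λ _ → 1) + binomialSum k (λ _ → 1)       ≡⟨ cong₂ _+_ (binomialSum-1 k) (binomialSum-1 k) ⟩
  2 ^ k + 2 ^ k                                           ≡⟨ cong (2 ^ k +_) (sym (+-identityʳ _)) ⟩
  2 ^ suc k                                               ∎

binomialSum-linear : ∀ k c → 2 * binomialSum k (λ q → q + c) ≡ (k + 2 * c) * 2 ^ k
binomialSum-linear zero    c = trans (cong (2 *_) (*-identityʳ c)) (sym (*-identityʳ (2 * c)))
binomialSum-linear (suc k) c = begin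
  2 * binomialSum (suc k) (λ q → q + c)
    ≡⟨ cong (2 *_) (binomialSum-suc k (λ q → q + c)) ⟩
  2 * (binomialSum k (λ q → q + c) + binomialSum k (λ q → suc q + c))
    ≡⟨ cong (λ x → 2 * (binomialSum k (λ q → q + c) + x)) shifted ⟩
  2 * (binomialSum k (λ q → q + c) + (binomialSum k (λ q → q + c) + 2 ^ k))
    ≡⟨ rearrange (binomialSum k (λ q → q + c)) (2 ^ k) ⟩
  2 * binomialSum k (λ q → q + c) + 2 * binomialSum k (λ q → q + c) + 2 * 2 ^ k
    ≡⟨ cong (λ x → x + x + 2 * 2 ^ k) (binomialSum-linear k c) ⟩
  (k + 2 * c) * 2 ^ k + (k + 2 * c) * 2 ^ k + 2 * 2 ^ k
    ≡⟨ collect k c (2 ^ k) ⟩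
  (suc k + 2 * c) * 2 ^ suc k ∎
  where
  shifted : binomialSum k (λ q → suc q + c) ≡ binomialSum k (λ q → q + c) + 2 ^ k
  shifted = begin
    binomialSum k (λ q → suc q + c)
      ≡⟨ sum≤-cong k (λ q → trans (cong (_* (k C q)) (+-comm 1 (q + c))) (*-distribʳ-+ (k C q) (q + c) 1)) ⟩
    sum≤ k (λ q → (q + c) * (k C q) + 1 * (k C q))
      ≡⟨ sum≤-+ k _ _ ⟩
    binomialSum k (λ q → q + c) + binomialSum k (λ _ → 1)
      ≡⟨ cong (binomialSum k (λ q → q + c) +_) (binomialSum-1 k) ⟩
    binomialSum k (λ q → q + c) + 2 ^ k ∎
  rearrange : ∀ x y → 2 * (x + (x + y)) ≡ 2 * x + 2 * x + 2 * y
  rearrange = solve-∀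
  collect : ∀ k c y → (k + 2 * c) * y + (k + 2 * c) * y + 2 * y ≡ (suc k + 2 * c) * (2 * y)
  collect = solve-∀

sumFrom1-closed : ∀ j → 2 * sumFrom1 (suc j) (λ p → (p + 1) * (j C (p ∸ 1))) ≡ (j + 4) * 2 ^ j
sumFrom1-closed j = begin
  2 * sumFrom1 (suc j) (λ p → (p + 1) * (j C (p ∸ 1)))
    ≡⟨ cong (2 *_) (sumFrom1-suc j _) ⟩
  2 * sum≤ j (λ q → (suc q + 1) * (j C q))
    ≡⟨ cong (2 *_) (sum≤-cong j (λ q → cong (_* (j C q)) (sym (+-suc q 1)))) ⟩
  2 * binomialSum j (λ q → q + 2)
    ≡⟨ binomialSum-linear j 2 ⟩
  (j + 4) * 2 ^ j ∎

mainTheorem1 : (n i : ℕ) → 2 ≤ n → 1 ≤ i → i ≤ n ∸ 1 →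
    r n i ≡ sumFrom1 (n ∸ i) (λ p → (p + 1) * ((n ∸ i ∸ 1) C (p ∸ 1)))
mainTheorem1 (suc n) (suc i) _ _ i<n with m≤n⇒∃[o]m+o≡n i<n
... | j , refl rewrite trans (cong (_∸ i) (sym (+-suc i j))) (m+n∸m≡n i (suc j)) =
  *-cancelˡ-≡ _ _ 2 (trans (r-closed i j) (sym (sumFrom1-closed j)))
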